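{- Let $G$ be an absolute-clear connected graph and $H$ a connected graph. Consider all mutual-visibility sets $S$ of $G\odot H$ of the form $S = Q \cup S_{\overline{Q}}$ with $\emptyset \neq Q \subsetneq V(G)$, $\overline{Q} = V(G)\setminus Q$ and $\emptyset \neq S_{\overline{Q}} \subseteq \bigcup_{w\in\overline{Q}} V(H_w)$. Then $$\sum_{S} x^{|S|} \;=\; \sum_{Q}\ \sum_{\Omega_Q(G)} \left( (1+x)^{|\Omega_Q(G)|\,|V(H)|} - 1 \right) x^{|Q|},$$ where the outer sum on the right runs over all non-empty proper subsets $Q \subsetneq V(G)$ that are mutual-visibility sets of $G$, and the inner sum runs over all maximal absolute $c_Q$-visible sets $\Omega_Q(G)$ of $G$.
   Context: All graphs are finite, simple, undirected and connected. For a graph $G$ and $X \subseteq V(G)$, two vertices $u,v$ are $X$-visible if there exists a shortest $(u,v)$-path $P$ in $G$ with $V(P)\cap X \subseteq \{u,v\}$; a set $Y$ is $X$-visible if every two vertices of $Y$ are $X$-visible. A set $X\subseteq V(G)$ is a mutual-visibility set of $G$ if it is $X$-visible. For $Q\subseteq V(G)$, a set $W\subseteq \overline{Q}=V(G)\setminus Q$ is $c_Q$-visible if $W$ is $Q$-visible and $u,w$ are $Q$-visible for all $u\in Q$, $w\in W$; it is an absolute $c_Q$-visible set if moreover $Q$ is a mutual-visibility set of $G$. A maximal absolute $c_Q$-visible set (one not properly contained in another absolute $c_Q$-visible set) is denoted $\Omega_Q(G)$. A subset $Q$ is disjoint-visible if, whenever there is more than one maximal absolute $c_Q$-visible set, these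 sets are pairwise disjoint; $G$ is absolute-clear if every non-empty subset of $V(G)$ is disjoint-visible. The corona $G\odot H$ is obtained from one copy of $G$ and $|V(G)|$ copies of $H$, the copy associated with $v\in V(G)$ being denoted $H_v$, by joining each $v \in V(G)$ to every vertex of $H_v$. -}

module Defs where

open import Data.Nat using (ℕ; zero; suc; _+_; _*_; _∸_; _^_; _≤_)
open import Data.Bool using (Bool; true; false; T; _∧_)
open import Data.Fin using (Fin; splitAt; remQuot; _↑ˡ_; _↑ʳ_; combine)
open import Data.Fin.Properties using () renaming (_≟_ to _≟F_)
open import Data.Fin.Subset using (Subset; _∈_; _∩_; _∪_; _⊆_; _⊂_; ∁; ⊤; Nonempty; Empty; ∣_∣)
open import Data.Vec using (tabulate; lookup)
open import Data.List using (List; []; _∷_; map)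
open import Data.Nat.ListAction using (sum)
open import Data.List.Relation.Unary.All using (All)
open import Data.List.Relation.Unary.Unique.Propositional using (Unique)
open import Data.List.Membership.Propositional using () renaming (_∈_ to _∈L_)
open import Data.Product using (Σ; ∃; _×_; _,_; proj₁; proj₂)
open import Data.Sum using (_⊎_; inj₁; inj₂)
open import Relation.Nullary using (¬_)
open import Relation.Nullary.Decidable using (⌊_⌋)
open import Relation.Binary.PropositionalEquality using (_≡_; _≢_)
open import Function.Bundles using (_⇔_)

record Graph : Set where
  constructor mkGraph
  field
    n   : ℕ
    adj : Fin n → Fin n → Bool
open Graph public

Adj : (G : Graph) → Fin (n G) → Fin (n G) → Set
Adj G u v = T (adj G u v)

data Walk (G : Graph) : Fin (n G) → Fin (n G) → Set where
  []  : ∀ {u} → Walk G u u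
  _∷_ : ∀ {u w v} → Adj G u w → Walk G w v → Walk G u v

len : ∀ {G u v} → Walk G u v → ℕ
len []      = 0
len (_ ∷ p) = suc (len p)

vertices : ∀ {G u v} → Walk G u v → List (Fin (n G))
vertices {u = u} []          = u ∷ []
vertices {u = u} (_ ∷ p)     = u ∷ vertices p

-- A shortest (u,v)-walk (necessarily a path).
IsShortest : ∀ {G u v} → Walk G u v → Set
IsShortest {G} {u} {v} p = (q : Walk G u v) → len p ≤ len q

IsConnectedSimpleGraph : Graph → Set
IsConnectedSimpleGraph G =
  (∀ u v → adj G u v ≡ adj G v u) ×
  (∀ u → adj G u u ≡ false) ×
  (∀ (u v : Fin (n G)) → Walk G u v)

module _ (G : Graph) where

  Visible : Subset (n G) → Fin (n G) → Fin (n G) → Set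
  Visible X u v = Σ (Walk G u v) λ p → IsShortest p ×
    All (λ z → z ∈ X → (z ≡ u ⊎ z ≡ v)) (vertices p)

  VisibleSet : Subset (n G) → Subset (n G) → Set
  VisibleSet X Y = ∀ u v → u ∈ Y → v ∈ Y → Visible X u v

  MutualVisibility : Subset (n G) → Set
  MutualVisibility X = VisibleSet X X

  CVisible : Subset (n G) → Subset (n G) → Set
  CVisible Q W = W ⊆ ∁ Q × VisibleSet Q W × (∀ u w → u ∈ Q → w ∈ W → Visible Q u w)

  AbsCVisible : Subset (n G) → Subset (n G) → Set
  AbsCVisible Q W = CVisible Q W × MutualVisibility Q

  MaxAbsCVisible : Subset (n G) → Subset (n G) → Set
  MaxAbsCVisible Q W = AbsCVisible Q W × (∀ W' → AbsCVisible Q W' → W ⊆ W' → W' ⊆ W)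

  DisjointVisible : Subset (n G) → Set
  DisjointVisible Q = ∀ W₁ W₂ → MaxAbsCVisible Q W₁ → MaxAbsCVisible Q W₂ →
    W₁ ≢ W₂ → Empty (W₁ ∩ W₂)

  AbsoluteClear : Set
  AbsoluteClear = ∀ Q → Nonempty Q → DisjointVisible Q

-- Corona G ⊙ H. Vertex i ↑ˡ (n H * ... ) i.e. index i < n G is the vertex i of G;
-- vertex n G ↑ʳ combine v h is vertex h of the copy H_v.
coronaAdj : (G H : Graph) → Fin (n G + n G * n H) → Fin (n G + n G * n H) → Bool
coronaAdj G H i j with splitAt (n G) i | splitAt (n G) j
... | inj₁ a | inj₁ b = adj G a b
... | inj₁ a | inj₂ y = ⌊ a ≟F proj₁ (remQuot {n G} (n H) y) ⌋
... | inj₂ x | inj₁ b = ⌊ proj₁ (remQuot {n G} (n H) x) ≟F b ⌋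
... | inj₂ x | inj₂ y = ⌊ proj₁ (remQuot {n G} (n H) x) ≟F proj₁ (remQuot {n G} (n H) y) ⌋
                          ∧ adj H (proj₂ (remQuot {n G} (n H) x)) (proj₂ (remQuot {n G} (n H) y))

corona : Graph → Graph → Graph
corona G H = mkGraph (n G + n G * n H) (coronaAdj G H)

liftG : (G H : Graph) → Subset (n G) → Subset (n G + n G * n H)
liftG G H Q = tabulate λ i → f (splitAt (n G) i)
  where
  f : Fin (n G) ⊎ Fin (n G * n H) → Bool
  f (inj₁ a) = lookup Q a
  f (inj₂ _) = false

copiesOver : (G H : Graph) → Subset (n G) → Subset (n G + n G * n H)
copiesOver G H R = tabulate λ i → f (splitAt (n G) i)
  where
  f : Fin (n G) ⊎ Fin (n G * n H) → Bool
  f (inj₁ _) = false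
  f (inj₂ y) = lookup R (proj₁ (remQuot {n G} (n H) y))

Enumerates : {A : Set} → (A → Set) → List A → Set
Enumerates P L = Unique L × (∀ a → (a ∈L L) ⇔ P a)

IsCoronaMVForm : (G H : Graph) → Subset (n G + n G * n H) → Set
IsCoronaMVForm G H S =
  MutualVisibility (corona G H) S ×
  ∃ λ (Q : Subset (n G)) → ∃ λ (T : Subset (n G + n G * n H)) →
    Nonempty Q × Q ⊂ ⊤ × Nonempty T × T ⊆ copiesOver G H (∁ Q) ×
    S ≡ liftG G H Q ∪ T

IsProperNonemptyMV : (G : Graph) → Subset (n G) → Set
IsProperNonemptyMV G Q = Nonempty Q × Q ⊂ ⊤ × MutualVisibility G Q

sumOver : {A : Set} → List A → (A → ℕ) → ℕ
sumOver L f = sum (map f L)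

{-# OPTIONS --safe #-}
-- Collapsing every copy H_w onto its root w turns a walk of G ⊙ H into a walk of G that is
-- no longer, and any walk that leaves a copy passes through its root.  Hence S = Q ∪ S_Q̄ is a
-- mutual-visibility set of G ⊙ H exactly when Q together with the set W of roots of S_Q̄ is
-- pairwise Q-visible in G, i.e. when W is an absolute c_Q-visible set.  Such a W lies in some
-- Ω_Q(G), and in only one because G is absolute-clear.  So the sets S are listed without
-- repetition by choosing Q, then Ω_Q(G), then a non-empty subset of the |Ω_Q(G)|·|V(H)|
-- vertices of the copies over Ω_Q(G); summing x^|S| over the last choice gives
-- x^|Q| ((1 + x)^(|Ω_Q(G)|·|V(H)|) − 1).
module Submission where

open import Defs
open import Data.Nat using (ℕ; zero; suc; _+_; _*_; _∸_; _^_; _≤_; z≤n; s≤s) renaming (_≟_ to _≟ℕ_)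
open import Data.Nat.Properties
  using (≤-trans; m≤n⇒m≤1+n; +-comm; *-comm; +-cancelˡ-≤; +-cancelʳ-≤; +-monoˡ-≤; +-monoʳ-≤; 0≢1+n;
         *-zeroʳ; *-distribˡ-+; ^-distribˡ-+-*)
open import Data.Nat.ListAction using (sum)
open import Data.Nat.ListAction.Properties using (sum-++; sum-↭)
open import Data.Bool using (Bool; true; false; T; T?; _∧_; _∨_)
import Data.Bool
open import Data.Bool.Properties using (T-∧; T-≡)
open import Data.Fin using (Fin; zero; suc; splitAt; combine; quotient; remainder; _↑ˡ_; _↑ʳ_)
open import Data.Fin.Properties
  using (splitAt-↑ˡ; splitAt-↑ʳ; splitAt⁻¹-↑ˡ; splitAt⁻¹-↑ʳ; remQuot-combine; combine-remQuot; ↑ʳ-injective;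
         combine-injectiveʳ; any?)
  renaming (_≟_ to _≟F_)
open import Data.Fin.Subset using (Subset; _∈_; _∉_; _⊆_; _⊂_; _⊃_; _∪_; ∁; ⊥; ⊤; Nonempty; ∣_∣)
open import Data.Fin.Subset.Properties
  using (∣⊥∣≡0; ∣⊤∣≡n; nonempty?; Empty-unique; ∉⊥; drop-∷-⊆; out⊆; in⊆in; ⊆-trans; ⊆-refl; _⊆?_; _∈?_;
         x∈∁p⇒x∉p; x∈p∩q⁺; ∪-identityˡ; ∪-identityʳ)
open import Data.Fin.Subset.Induction using (⊃-wellFounded)
import Data.Vec
open import Data.Vec using (Vec; []; _∷_; _++_; lookup; tabulate; replicate; concat; here; there)
  renaming (map to mapᵥ)
import Data.Vec.Properties
open import Data.Vec.Properties
  using (∷-injectiveʳ; ++-injectiveˡ; ++-injectiveʳ; lookup-++ˡ; lookup-++ʳ; []=⇒lookup; lookup⇒[]=;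
         lookup-concat; lookup-map; lookup-replicate; lookup∘tabulate; tabulate∘lookup; tabulate-cong;
         lookup-splitAt; zipWith-++)
open import Data.List using (List; []; _∷_; map; concatMap) renaming (_++_ to _++ₗ_)
open import Data.List.Properties using (map-++; map-∘; map-cong)
open import Data.List.Relation.Unary.All as All using (All; []; _∷_)
open import Data.List.Relation.Unary.Any using (here; there)
open import Data.List.Relation.Unary.Unique.Propositional using (Unique; []; _∷_)
import Data.List.Relation.Unary.Unique.Propositional.Properties as Unique
open import Data.List.Membership.Propositional using (find; lose) renaming (_∈_ to _∈ₗ_)
open import Data.List.Membership.Propositional.Properties
  using (∈-map⁺; ∈-map⁻; ∈-++⁺ˡ; ∈-++⁺ʳ; ∈-++⁻; ∈-concatMap⁺; ∈-concatMap⁻)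
open import Data.List.Membership.Propositional.Properties.WithK using (unique∧set⇒bag)
open import Data.List.Relation.Binary.BagAndSetEquality using (∼bag⇒↭)
import Data.List.Relation.Binary.Permutation.Propositional.Properties as Perm
open import Data.Product using (∃; ∃₂; _×_; _,_; proj₁; proj₂)
open import Data.Sum as Sum using (_⊎_; inj₁; inj₂; [_,_]′)
open import Data.Empty using (⊥-elim)
open import Function using (id; const; _∘_; _∋_; _⇔_; mk⇔; Equivalence)
open import Induction.WellFounded using (Acc; acc)
open import Relation.Nullary using (¬_; Dec; yes; no)
open import Relation.Nullary.Negation using (¬¬-map)
open import Relation.Nullary.Decidable using (decidable-stable; ⌊_⌋; toWitness; fromWitness; _×-dec_; ¬?)
open import Relation.Binary.PropositionalEquality
  using (_≡_; _≢_; refl; sym; trans; cong; cong₂; subst; subst₂; module ≡-Reasoning)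

open Equivalence using (to; from)

sumOver-++ : ∀ {A : Set} (xs ys : List A) (f : A → ℕ) → sumOver (xs ++ₗ ys) f ≡ sumOver xs f + sumOver ys f
sumOver-++ xs ys f = trans (cong sum (map-++ f xs ys)) (sum-++ (map f xs) (map f ys))

sumOver-map : ∀ {A B : Set} (g : A → B) (xs : List A) (f : B → ℕ) → sumOver (map g xs) f ≡ sumOver xs (f ∘ g)
sumOver-map g xs f = cong sum (sym (map-∘ xs))

sumOver-cong : ∀ {A : Set} (xs : List A) {f g : A → ℕ} → (∀ a → f a ≡ g a) → sumOver xs f ≡ sumOver xs g
sumOver-cong xs f≗g = cong sum (map-cong f≗g xs)

sumOver-*ˡ : ∀ {A : Set} (c : ℕ) (xs : List A) (f : A → ℕ) → sumOver xs (λ a → c * f a) ≡ c * sumOver xs f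
sumOver-*ˡ c []       f = sym (*-zeroʳ c)
sumOver-*ˡ c (a ∷ xs) f = trans (cong (c * f a +_) (sumOver-*ˡ c xs f)) (sym (*-distribˡ-+ c (f a) _))

sumOver-concatMap : ∀ {A B : Set} (g : A → List B) (xs : List A) (f : B → ℕ) →
  sumOver (concatMap g xs) f ≡ sumOver xs (λ a → sumOver (g a) f)
sumOver-concatMap g []       f = refl
sumOver-concatMap g (a ∷ xs) f =
  trans (sumOver-++ (g a) (concatMap g xs) f) (cong (sumOver (g a) f +_) (sumOver-concatMap g xs f))

sumOver-unique-⇔ : ∀ {A : Set} {xs ys : List A} → Unique xs → Unique ys → (∀ {a} → a ∈ₗ xs ⇔ a ∈ₗ ys) →
  (f : A → ℕ) → sumOver xs f ≡ sumOver ys f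
sumOver-unique-⇔ xs! ys! xs⇔ys f = sum-↭ (Perm.map⁺ f (∼bag⇒↭ (unique∧set⇒bag xs! ys! xs⇔ys)))

concatMap-unique : ∀ {A B : Set} (g : A → List B) {xs : List A} → Unique xs →
  (∀ {a} → a ∈ₗ xs → Unique (g a)) →
  (∀ {a a′ b} → a ∈ₗ xs → a′ ∈ₗ xs → b ∈ₗ g a → b ∈ₗ g a′ → a ≡ a′) →
  Unique (concatMap g xs)
concatMap-unique g {[]}     _            _  _       = []
concatMap-unique g {a ∷ xs} (a∉xs ∷ xs!) g! shared⇒≡ =
  Unique.++⁺ (g! (here refl)) (concatMap-unique g xs! (g! ∘ there) (λ i j → shared⇒≡ (there i) (there j)))
    (λ (b∈ga , b∈rest) → let a′ , a′∈xs , b∈ga′ = find (∈-concatMap⁻ g b∈rest) in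
      All.lookup a∉xs a′∈xs (shared⇒≡ (here refl) (there a′∈xs) b∈ga b∈ga′))

mutual
  subsetsOf : ∀ {n} → Subset n → List (Subset n)
  subsetsOf A = ⊥ ∷ nonemptySubsetsOf A

  nonemptySubsetsOf : ∀ {n} → Subset n → List (Subset n)
  nonemptySubsetsOf []          = []
  nonemptySubsetsOf (false ∷ A) = map (false ∷_) (nonemptySubsetsOf A)
  nonemptySubsetsOf (true ∷ A)  = map (false ∷_) (nonemptySubsetsOf A) ++ₗ map (true ∷_) (subsetsOf A)

sumOver-subsetsOf : ∀ {n} (x : ℕ) (A : Subset n) → sumOver (subsetsOf A) (λ T → x ^ ∣ T ∣) ≡ (1 + x) ^ ∣ A ∣
sumOver-subsetsOf x []          = refl
sumOver-subsetsOf x (false ∷ A) = trans (sumOver-map (false ∷_) (subsetsOf A) _) (sumOver-subsetsOf x A)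
sumOver-subsetsOf x (true ∷ A)  = begin
  sumOver (map (false ∷_) (subsetsOf A) ++ₗ map (true ∷_) (subsetsOf A)) x^∣_∣
    ≡⟨ sumOver-++ (map (false ∷_) (subsetsOf A)) _ x^∣_∣ ⟩
  sumOver (map (false ∷_) (subsetsOf A)) x^∣_∣ + sumOver (map (true ∷_) (subsetsOf A)) x^∣_∣
    ≡⟨ cong₂ _+_ (sumOver-map (false ∷_) (subsetsOf A) x^∣_∣)
                 (trans (sumOver-map (true ∷_) (subsetsOf A) x^∣_∣) (sumOver-*ˡ x (subsetsOf A) x^∣_∣)) ⟩
  sumOver (subsetsOf A) x^∣_∣ + x * sumOver (subsetsOf A) x^∣_∣
    ≡⟨ cong (λ s → s + x * s) (sumOver-subsetsOf x A) ⟩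
  (1 + x) ^ ∣ A ∣ + x * (1 + x) ^ ∣ A ∣ ∎
  where
  open ≡-Reasoning
  x^∣_∣ : ∀ {n} → Subset n → ℕ
  x^∣ T ∣ = x ^ ∣ T ∣

sumOver-nonemptySubsetsOf : ∀ {n} (x : ℕ) (A : Subset n) →
  sumOver (nonemptySubsetsOf A) (λ T → x ^ ∣ T ∣) ≡ (1 + x) ^ ∣ A ∣ ∸ 1
-- x ^ 0 + s ∸ 1 computes to s, so dropping the empty subset only needs ∣ ⊥ ∣ ≡ 0.
sumOver-nonemptySubsetsOf {n} x A = begin
  s                                ≡⟨ cong (λ e → x ^ e + s ∸ 1) (∣⊥∣≡0 n) ⟨
  x ^ ∣ ⊥ {n} ∣ + s ∸ 1            ≡⟨ cong (_∸ 1) (sumOver-subsetsOf x A) ⟩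
  (1 + x) ^ ∣ A ∣ ∸ 1              ∎
  where
  open ≡-Reasoning
  s : ℕ
  s = sumOver (nonemptySubsetsOf A) (λ T → x ^ ∣ T ∣)

subsetsOf-unique : ∀ {n} (A : Subset n) → Unique (subsetsOf A)
subsetsOf-unique []          = [] ∷ []
subsetsOf-unique (false ∷ A) = Unique.map⁺ ∷-injectiveʳ (subsetsOf-unique A)
subsetsOf-unique (true ∷ A)  =
  Unique.++⁺ (Unique.map⁺ ∷-injectiveʳ (subsetsOf-unique A)) (Unique.map⁺ ∷-injectiveʳ (subsetsOf-unique A))
    false∷≢true∷
  where
  false∷≢true∷ : ∀ {T} → ¬ (T ∈ₗ map (false ∷_) (subsetsOf A) × T ∈ₗ map (true ∷_) (subsetsOf A))
  false∷≢true∷ (f , t) with ∈-map⁻ (false ∷_) f | ∈-map⁻ (true ∷_) t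
  ... | _ , _ , refl | _ , _ , ()

nonemptySubsetsOf-unique : ∀ {n} (A : Subset n) → Unique (nonemptySubsetsOf A)
nonemptySubsetsOf-unique A with subsetsOf-unique A
... | _ ∷ rest! = rest!

⊆⇒∈-subsetsOf : ∀ {n} (A : Subset n) {T} → T ⊆ A → T ∈ₗ subsetsOf A
⊆⇒∈-subsetsOf []          {[]}       _   = here refl
⊆⇒∈-subsetsOf (false ∷ A) {false ∷ T} T⊆A = ∈-map⁺ (false ∷_) (⊆⇒∈-subsetsOf A (drop-∷-⊆ T⊆A))
⊆⇒∈-subsetsOf (false ∷ A) {true ∷ T}  T⊆A with () ← T⊆A here
⊆⇒∈-subsetsOf (true ∷ A)  {false ∷ T} T⊆A = ∈-++⁺ˡ (∈-map⁺ (false ∷_) (⊆⇒∈-subsetsOf A (drop-∷-⊆ T⊆A)))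
⊆⇒∈-subsetsOf (true ∷ A)  {true ∷ T}  T⊆A =
  ∈-++⁺ʳ (map (false ∷_) (subsetsOf A)) (∈-map⁺ (true ∷_) (⊆⇒∈-subsetsOf A (drop-∷-⊆ T⊆A)))

∈-subsetsOf⇒⊆ : ∀ {n} (A : Subset n) {T} → T ∈ₗ subsetsOf A → T ⊆ A
∈-subsetsOf⇒⊆ []          (here refl) = λ ()
∈-subsetsOf⇒⊆ (false ∷ A) T∈ with ∈-map⁻ (false ∷_) T∈
... | _ , T′∈ , refl = out⊆ (∈-subsetsOf⇒⊆ A T′∈)
∈-subsetsOf⇒⊆ (true ∷ A)  T∈ with ∈-++⁻ (map (false ∷_) (subsetsOf A)) T∈
... | inj₁ T∈₀ with _ , T′∈ , refl ← ∈-map⁻ (false ∷_) T∈₀ = out⊆ (∈-subsetsOf⇒⊆ A T′∈)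
... | inj₂ T∈₁ with _ , T′∈ , refl ← ∈-map⁻ (true ∷_) T∈₁ = in⊆in (∈-subsetsOf⇒⊆ A T′∈)

∈-nonemptySubsetsOf⇔ : ∀ {n} (A : Subset n) {T} → T ∈ₗ nonemptySubsetsOf A ⇔ (T ⊆ A × Nonempty T)
∈-nonemptySubsetsOf⇔ A {T} = mk⇔ sound complete
  where
  sound : T ∈ₗ nonemptySubsetsOf A → T ⊆ A × Nonempty T
  sound T∈ with nonempty? T | subsetsOf-unique A
  ... | yes ne   | _          = ∈-subsetsOf⇒⊆ A (there T∈) , ne
  ... | no ¬ne   | ⊥∉rest ∷ _ = ⊥-elim (All.lookup ⊥∉rest (subst (_∈ₗ _) (Empty-unique ¬ne) T∈) refl)

  complete : T ⊆ A × Nonempty T → T ∈ₗ nonemptySubsetsOf A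
  complete (T⊆A , x , x∈T) with ⊆⇒∈-subsetsOf A T⊆A
  ... | here refl = ⊥-elim (∉⊥ x∈T)
  ... | there T∈  = T∈

⊈⇒∃∈∉ : ∀ {n} {p q : Subset n} → ¬ p ⊆ q → ∃ λ x → x ∈ p × x ∉ q
⊈⇒∃∈∉ {p = p} {q} p⊈q with any? (λ x → x ∈? p ×-dec ¬? (x ∈? q))
... | yes found = found
... | no none    = ⊥-elim (p⊈q (λ {x} x∈p → decidable-stable (x ∈? q) (λ x∉q → none (x , x∈p , x∉q))))

Maximal : ∀ {n} → (Subset n → Set) → Subset n → Set
Maximal P V = P V × (∀ V′ → P V′ → V ⊆ V′ → V′ ⊆ V)

-- Doubly negated because P need not be decidable.
¬¬-maximal-superset : ∀ {n} (P : Subset n → Set) {W} → P W → ¬ ¬ ∃ λ V → Maximal P V × W ⊆ V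
¬¬-maximal-superset P {W} pW = extend W (⊃-wellFounded W) pW ⊆-refl
  where
  extend : ∀ V → Acc _⊃_ V → P V → W ⊆ V → ¬ ¬ ∃ λ V → Maximal P V × W ⊆ V
  extend V (acc larger) pV W⊆V ¬maximal = ¬maximal (V , (pV , maximal) , W⊆V)
    where
    maximal : ∀ V′ → P V′ → V ⊆ V′ → V′ ⊆ V
    maximal V′ pV′ V⊆V′ {x} = decidable-stable (V′ ⊆? V)
      (λ V′⊈V → extend V′ (larger (V⊆V′ , ⊈⇒∃∈∉ V′⊈V)) pV′ (⊆-trans W⊆V V⊆V′) ¬maximal) {x}

lookup-extensionality : ∀ {A : Set} {n} {xs ys : Vec A n} → (∀ i → lookup xs i ≡ lookup ys i) → xs ≡ ys
lookup-extensionality {xs = xs} {ys} eq =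
  trans (sym (tabulate∘lookup xs)) (trans (tabulate-cong eq) (tabulate∘lookup ys))

∈⇔lookup≡true : ∀ {n} {p : Subset n} {x} → x ∈ p ⇔ lookup p x ≡ true
∈⇔lookup≡true = mk⇔ []=⇒lookup (lookup⇒[]= _ _)

∈-resp-lookup : ∀ {m n} {p : Subset m} {q : Subset n} {x y} → lookup p x ≡ lookup q y → x ∈ p → y ∈ q
∈-resp-lookup eq x∈p = lookup⇒[]= _ _ (trans (sym eq) ([]=⇒lookup x∈p))

∣p++q∣≡∣p∣+∣q∣ : ∀ {m n} (p : Subset m) (q : Subset n) → ∣ p ++ q ∣ ≡ ∣ p ∣ + ∣ q ∣
∣p++q∣≡∣p∣+∣q∣ []          q = refl
∣p++q∣≡∣p∣+∣q∣ (true ∷ p)  q = cong suc (∣p++q∣≡∣p∣+∣q∣ p q)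
∣p++q∣≡∣p∣+∣q∣ (false ∷ p) q = ∣p++q∣≡∣p∣+∣q∣ p q

↑ˡ∈++⇔ : ∀ {m n} {p : Subset m} {q : Subset n} {i} → i ↑ˡ n ∈ p ++ q ⇔ i ∈ p
↑ˡ∈++⇔ {p = p} {q} {i} = mk⇔ (∈-resp-lookup (lookup-++ˡ p q i)) (∈-resp-lookup (sym (lookup-++ˡ p q i)))

↑ʳ∈++⇔ : ∀ {m n} {p : Subset m} {q : Subset n} {j} → m ↑ʳ j ∈ p ++ q ⇔ j ∈ q
↑ʳ∈++⇔ {p = p} {q} {j} = mk⇔ (∈-resp-lookup (lookup-++ʳ p q j)) (∈-resp-lookup (sym (lookup-++ʳ p q j)))

++-⊆⁺ : ∀ {m n} {p p′ : Subset m} {q q′ : Subset n} → p ⊆ p′ → q ⊆ q′ → p ++ q ⊆ p′ ++ q′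
++-⊆⁺ {p = []}    {[]}     _   q⊆q′ i∈       = q⊆q′ i∈
++-⊆⁺ {p = _ ∷ _} {_ ∷ _} p⊆p′ _    here     with here ← p⊆p′ here = here
++-⊆⁺ {p = _ ∷ _} {_ ∷ _} p⊆p′ q⊆q′ (there i∈) = there (++-⊆⁺ (drop-∷-⊆ p⊆p′) q⊆q′ i∈)

++-⊆⁻ : ∀ {m n} {p p′ : Subset m} {q q′ : Subset n} → p ++ q ⊆ p′ ++ q′ → p ⊆ p′ × q ⊆ q′
++-⊆⁻ pq⊆ = (to ↑ˡ∈++⇔ ∘ pq⊆ ∘ from ↑ˡ∈++⇔) ,
            (to ↑ʳ∈++⇔ ∘ pq⊆ ∘ from ↑ʳ∈++⇔)

Nonempty-++⁻ : ∀ {m n} (p : Subset m) {q : Subset n} → Nonempty (p ++ q) → Nonempty p ⊎ Nonempty q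
Nonempty-++⁻ []          ne                = inj₂ ne
Nonempty-++⁻ (true ∷ p)  _                 = inj₁ (zero , here)
Nonempty-++⁻ (false ∷ p) (suc i , there i∈) =
  Sum.map₁ (λ (j , j∈p) → suc j , there j∈p) (Nonempty-++⁻ p (i , i∈))

quotient-combine : ∀ {m} k (w : Fin m) (h : Fin k) → quotient k (combine w h) ≡ w
quotient-combine k w h = cong proj₁ (remQuot-combine w h)

replicateEach : ∀ {m} k → Subset m → Subset (m * k)
replicateEach k W = concat (mapᵥ (replicate k) W)

∣replicateEach∣ : ∀ {m} k (W : Subset m) → ∣ replicateEach k W ∣ ≡ ∣ W ∣ * k
∣replicateEach∣ k []          = refl
∣replicateEach∣ k (true ∷ W)  =
  trans (∣p++q∣≡∣p∣+∣q∣ (⊤ {k}) (replicateEach k W)) (cong₂ _+_ (∣⊤∣≡n k) (∣replicateEach∣ k W))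
∣replicateEach∣ k (false ∷ W) =
  trans (∣p++q∣≡∣p∣+∣q∣ (⊥ {k}) (replicateEach k W)) (cong₂ _+_ (∣⊥∣≡0 k) (∣replicateEach∣ k W))

lookup-replicateEach : ∀ {m} k (W : Subset m) j → lookup (replicateEach k W) j ≡ lookup W (quotient k j)
lookup-replicateEach {m} k W j = begin
  lookup (replicateEach k W) j
    ≡⟨ cong (lookup (replicateEach k W)) (combine-remQuot {m} k j) ⟨
  lookup (concat (mapᵥ (replicate k) W)) (combine (quotient {m} k j) (remainder {m} k j))
    ≡⟨ lookup-concat (mapᵥ (replicate k) W) _ _ ⟩
  lookup (lookup (mapᵥ (replicate k) W) (quotient k j)) (remainder {m} k j)
    ≡⟨ cong (λ v → lookup v (remainder {m} k j)) (lookup-map (quotient k j) (replicate k) W) ⟩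
  lookup (replicate k (lookup W (quotient k j))) (remainder {m} k j)
    ≡⟨ lookup-replicate (remainder {m} k j) _ ⟩
  lookup W (quotient k j) ∎
  where open ≡-Reasoning

∈-replicateEach⇔ : ∀ {m} k {W : Subset m} {j} → j ∈ replicateEach k W ⇔ quotient k j ∈ W
∈-replicateEach⇔ k {W} {j} =
  mk⇔ (∈-resp-lookup (lookup-replicateEach k W j)) (∈-resp-lookup (sym (lookup-replicateEach k W j)))

replicateEach-mono : ∀ {m} k {W W′ : Subset m} → W ⊆ W′ → replicateEach k W ⊆ replicateEach k W′
replicateEach-mono k W⊆W′ = from (∈-replicateEach⇔ k) ∘ W⊆W′ ∘ to (∈-replicateEach⇔ k)

shadow : ∀ {m} k → Subset (m * k) → Subset m
shadow {m} k T = tabulate λ w → ⌊ any? (λ h → combine w h ∈? T) ⌋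

∈-shadow⁺ : ∀ {m} k {T : Subset (m * k)} {w h} → combine w h ∈ T → w ∈ shadow {m} k T
∈-shadow⁺ {m} k {T} {w} {h} wh∈T = from ∈⇔lookup≡true
  (trans (lookup∘tabulate (λ w → ⌊ any? (λ h → combine w h ∈? T) ⌋) w) (to T-≡ (fromWitness (h , wh∈T))))

∈-shadow⁻ : ∀ {m} k {T : Subset (m * k)} {w} → w ∈ shadow {m} k T → ∃ λ h → combine w h ∈ T
∈-shadow⁻ {m} k {T} {w} w∈ = toWitness {a? = any? (λ h → combine w h ∈? T)}
  (from T-≡ (trans (sym (lookup∘tabulate (λ w → ⌊ any? (λ h → combine w h ∈? T) ⌋) w))
                               (to ∈⇔lookup≡true w∈)))

⊆-replicateEach-shadow : ∀ {m} k (T : Subset (m * k)) → T ⊆ replicateEach k (shadow {m} k T)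
⊆-replicateEach-shadow {m} k T {j} j∈T = from (∈-replicateEach⇔ k)
  (∈-shadow⁺ {m} k {T} (subst (_∈ T) (sym (combine-remQuot {m} k j)) j∈T))

shadow-⊆ : ∀ {m} k {T : Subset (m * k)} {W : Subset m} → T ⊆ replicateEach k W → shadow {m} k T ⊆ W
shadow-⊆ {m} k {T} {W} T⊆ {w} w∈ = let h , wh∈T = ∈-shadow⁻ {m} k {T} w∈ in
  subst (_∈ W) (quotient-combine k w h) (to (∈-replicateEach⇔ k) (T⊆ wh∈T))

module _ {G : Graph} where

  castWalk : ∀ {u u′ v v′} → u ≡ u′ → v ≡ v′ → Walk G u v → Walk G u′ v′
  castWalk refl refl p = p

  len-castWalk : ∀ {u u′ v v′} (eu : u ≡ u′) (ev : v ≡ v′) (p : Walk G u v) →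
    len (castWalk eu ev p) ≡ len p
  len-castWalk refl refl p = refl

  All-castWalk : ∀ {P : Fin (n G) → Set} {u u′ v v′} (eu : u ≡ u′) (ev : v ≡ v′) {p : Walk G u v} →
    All P (vertices p) → All P (vertices (castWalk eu ev p))
  All-castWalk refl refl ps = ps

  infixr 5 _++ᵂ_

  _++ᵂ_ : ∀ {u v w} → Walk G u v → Walk G v w → Walk G u w
  []      ++ᵂ q = q
  (e ∷ p) ++ᵂ q = e ∷ (p ++ᵂ q)

  len-++ᵂ : ∀ {u v w} (p : Walk G u v) (q : Walk G v w) → len (p ++ᵂ q) ≡ len p + len q
  len-++ᵂ []      q = refl
  len-++ᵂ (e ∷ p) q = cong suc (len-++ᵂ p q)

  All-++ᵂ : ∀ {P : Fin (n G) → Set} {u v w} (p : Walk G u v) {q : Walk G v w} →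
    All P (vertices p) → All P (vertices q) → All P (vertices (p ++ᵂ q))
  All-++ᵂ []      _          qs = qs
  All-++ᵂ (e ∷ p) (pu ∷ ps) qs = pu ∷ All-++ᵂ p ps qs

  All-first : ∀ {P : Fin (n G) → Set} {u v} (p : Walk G u v) → All P (vertices p) → P u
  All-first []      (pu ∷ _) = pu
  All-first (_ ∷ _) (pu ∷ _) = pu

  All-last : ∀ {P : Fin (n G) → Set} {u v} (p : Walk G u v) → All P (vertices p) → P v
  All-last []      (pv ∷ _) = pv
  All-last (_ ∷ p) (_ ∷ ps) = All-last p ps

  1≤len : ∀ {u v} → u ≢ v → (p : Walk G u v) → 1 ≤ len p
  1≤len u≢v []      = ⊥-elim (u≢v refl)
  1≤len u≢v (_ ∷ _) = s≤s z≤n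

  2≤len : ∀ {u v} → u ≢ v → ¬ Adj G u v → (p : Walk G u v) → 2 ≤ len p
  2≤len u≢v ¬e []          = ⊥-elim (u≢v refl)
  2≤len u≢v ¬e (e ∷ [])    = ⊥-elim (¬e e)
  2≤len u≢v ¬e (_ ∷ _ ∷ _) = s≤s (s≤s z≤n)

  Visible-refl : ∀ {X u} → Visible G X u u
  Visible-refl = [] , (λ _ → z≤n) , (λ _ → inj₁ refl) ∷ []

  module _ (Adj-sym : ∀ {u v} → Adj G u v → Adj G v u) where

    reverse : ∀ {u v} → Walk G u v → Walk G v u
    reverse []      = []
    reverse (e ∷ p) = reverse p ++ᵂ Adj-sym e ∷ []

    len-reverse : ∀ {u v} (p : Walk G u v) → len (reverse p) ≡ len p
    len-reverse []      = refl
    len-reverse (e ∷ p) = trans (len-++ᵂ (reverse p) (Adj-sym e ∷ []))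
                                (trans (cong (_+ 1) (len-reverse p)) (+-comm (len p) 1))

    All-reverse : ∀ {P : Fin (n G) → Set} {u v} (p : Walk G u v) →
      All P (vertices p) → All P (vertices (reverse p))
    All-reverse []      ps        = ps
    All-reverse (e ∷ p) (pu ∷ ps) = All-++ᵂ (reverse p) (All-reverse p ps) (All-first p ps ∷ pu ∷ [])

    Visible-sym : ∀ {X u v} → Visible G X u v → Visible G X v u
    Visible-sym (p , p-shortest , p-avoids) =
      reverse p ,
      (λ q → subst₂ _≤_ (sym (len-reverse p)) (len-reverse q) (p-shortest (reverse q))) ,
      All-reverse p (All.map (Sum.swap ∘_) p-avoids)

AbsCVisible-⊆ : ∀ {G : Graph} {Q W W′} → W′ ⊆ W → AbsCVisible G Q W → AbsCVisible G Q W′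
AbsCVisible-⊆ W′⊆W ((W⊆∁Q , W-visible , QW-visible) , Q-visible) =
  (W⊆∁Q ∘ W′⊆W ,
   (λ u v u∈ v∈ → W-visible u v (W′⊆W u∈) (W′⊆W v∈)) ,
   (λ u w u∈ w∈ → QW-visible u w u∈ (W′⊆W w∈))) ,
  Q-visible

module Corona (G H : Graph) where

  m k : ℕ
  m = n G
  k = n H

  C : Graph
  C = corona G H

  Vertex : Set
  Vertex = Fin (n C)

  inG : Fin m → Vertex
  inG a = a ↑ˡ (m * k)

  inH : Fin m → Fin k → Vertex
  inH w h = m ↑ʳ combine w h

  data View : Vertex → Set where
    inG-view : ∀ a → View (inG a)
    inH-view : ∀ w h → View (inH w h)

  view : ∀ x → View x
  view x with splitAt m x in eq
  ... | inj₁ a = subst View (splitAt⁻¹-↑ˡ eq) (inG-view a)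
  ... | inj₂ j = subst View (trans (cong (m ↑ʳ_) (combine-remQuot {m} k j)) (splitAt⁻¹-↑ʳ eq))
                   (inH-view (quotient k j) (remainder {m} k j))

  inH-injectiveʳ : ∀ {w h h′} → inH w h ≡ inH w h′ → h ≡ h′
  inH-injectiveʳ {w} {h} {h′} eq = combine-injectiveʳ w h w h′ (↑ʳ-injective m _ _ eq)

  -- x lies at distance depth x ∈ {0, 1} from root x: x itself, or the vertex of G
  -- whose copy of H contains x.
  root : Vertex → Fin m
  root x = [ id , quotient k ]′ (splitAt m x)

  depth : Vertex → ℕ
  depth x = [ const 0 , const 1 ]′ (splitAt m x)

  root-inG : ∀ a → root (inG a) ≡ a
  root-inG a rewrite splitAt-↑ˡ m a (m * k) = refl

  root-inH : ∀ w h → root (inH w h) ≡ w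
  root-inH w h rewrite splitAt-↑ʳ m (m * k) (combine w h) = quotient-combine k w h

  depth-inG : ∀ a → depth (inG a) ≡ 0
  depth-inG a rewrite splitAt-↑ˡ m a (m * k) = refl

  depth-inH : ∀ w h → depth (inH w h) ≡ 1
  depth-inH w h rewrite splitAt-↑ʳ m (m * k) (combine w h) = refl

  depth≤1 : ∀ x → depth x ≤ 1
  depth≤1 x with splitAt m x
  ... | inj₁ _ = z≤n
  ... | inj₂ _ = s≤s z≤n

  depth≡0⊎depth≡1 : ∀ x → depth x ≡ 0 ⊎ depth x ≡ 1
  depth≡0⊎depth≡1 x with splitAt m x
  ... | inj₁ _ = inj₁ refl
  ... | inj₂ _ = inj₂ refl

  depth≡0⇒inG-root : ∀ {x} → depth x ≡ 0 → inG (root x) ≡ x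
  depth≡0⇒inG-root {x} d≡0 with view x
  ... | inG-view a   = cong inG (root-inG a)
  ... | inH-view w h with () ← trans (sym (depth-inH w h)) d≡0

  SameCopy : Vertex → Vertex → Set
  SameCopy x y = depth x ≡ 1 × depth y ≡ 1 × root x ≡ root y

  sameCopy? : ∀ x y → Dec (SameCopy x y)
  sameCopy? x y = (depth x ≟ℕ 1) ×-dec (depth y ≟ℕ 1) ×-dec (root x ≟F root y)

  ¬SameCopy-self⇒depth≡0 : ∀ {x} → ¬ SameCopy x x → depth x ≡ 0
  ¬SameCopy-self⇒depth≡0 {x} ¬same with depth≡0⊎depth≡1 x
  ... | inj₁ dx≡0 = dx≡0
  ... | inj₂ dx≡1 = ⊥-elim (¬same (dx≡1 , dx≡1 , refl))

  adj-inG-inG : ∀ a b → adj C (inG a) (inG b) ≡ adj G a b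
  adj-inG-inG a b rewrite splitAt-↑ˡ m a (m * k) | splitAt-↑ˡ m b (m * k) = refl

  adj-inG-inH : ∀ a w h → adj C (inG a) (inH w h) ≡ ⌊ a ≟F w ⌋
  adj-inG-inH a w h rewrite splitAt-↑ˡ m a (m * k) | splitAt-↑ʳ m (m * k) (combine w h) =
    cong (λ z → ⌊ a ≟F z ⌋) (quotient-combine k w h)

  adj-inH-inG : ∀ w h a → adj C (inH w h) (inG a) ≡ ⌊ w ≟F a ⌋
  adj-inH-inG w h a rewrite splitAt-↑ˡ m a (m * k) | splitAt-↑ʳ m (m * k) (combine w h) =
    cong (λ z → ⌊ z ≟F a ⌋) (quotient-combine k w h)

  adj-inH-inH : ∀ w h w′ h′ → adj C (inH w h) (inH w′ h′) ≡ ⌊ w ≟F w′ ⌋ ∧ adj H h h′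
  adj-inH-inH w h w′ h′ rewrite splitAt-↑ʳ m (m * k) (combine w h) | splitAt-↑ʳ m (m * k) (combine w′ h′)
                              =
    cong₂ (λ (p q : Fin m × Fin k) → ⌊ proj₁ p ≟F proj₁ q ⌋ ∧ adj H (proj₂ p) (proj₂ q))
          (remQuot-combine w h) (remQuot-combine w′ h′)

  inG-edge : ∀ {a b} → Adj G a b → Adj C (inG a) (inG b)
  inG-edge {a} {b} = subst T (sym (adj-inG-inG a b))

  inG-inH-edge : ∀ {w h} → Adj C (inG w) (inH w h)
  inG-inH-edge {w} {h} = subst T (sym (adj-inG-inH w w h)) (fromWitness refl)

  inH-inG-edge : ∀ {w h} → Adj C (inH w h) (inG w)
  inH-inG-edge {w} {h} = subst T (sym (adj-inH-inG w h w)) (fromWitness refl)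

  inH-edge⇔ : ∀ {w h h′} → Adj C (inH w h) (inH w h′) ⇔ Adj H h h′
  inH-edge⇔ {w} {h} {h′} = mk⇔
    (λ e → proj₂ (to (T-∧ {⌊ w ≟F w ⌋}) (subst T (adj-inH-inH w h w h′) e)))
    (λ e → subst T (sym (adj-inH-inH w h w h′)) (from (T-∧ {⌊ w ≟F w ⌋}) (fromWitness refl , e)))

  edge-root : ∀ {x y} → Adj C x y → root x ≡ root y ⊎ (depth x ≡ 0 × depth y ≡ 0 × Adj G (root x) (root y))
  edge-root {x} {y} e with view x | view y
  ... | inG-view a | inG-view b = inj₂ (depth-inG a , depth-inG b ,
          subst₂ (Adj G) (sym (root-inG a)) (sym (root-inG b)) (subst T (adj-inG-inG a b) e))
  ... | inG-view a | inH-view w h = inj₁ (trans (root-inG a)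
          (trans (toWitness (subst T (adj-inG-inH a w h) e)) (sym (root-inH w h))))
  ... | inH-view w h | inG-view a = inj₁ (trans (root-inH w h)
          (trans (toWitness (subst T (adj-inH-inG w h a) e)) (sym (root-inG a))))
  ... | inH-view w h | inH-view w′ h′ = inj₁ (trans (root-inH w h)
          (trans (toWitness (proj₁ (to (T-∧ {⌊ w ≟F w′ ⌋}) (subst T (adj-inH-inH w h w′ h′) e))))
                 (sym (root-inH w′ h′))))

  project : ∀ {x y} → Walk C x y → Walk G (root x) (root y)
  project []      = []
  project (e ∷ p) with edge-root e
  ... | inj₁ same           = castWalk (sym same) refl (project p)
  ... | inj₂ (_ , _ , e′) = e′ ∷ project p

  len-project≤ : ∀ {x y} (p : Walk C x y) → len (project p) ≤ len p
  len-project≤ []      = z≤n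
  len-project≤ (e ∷ p) with edge-root e
  ... | inj₁ same rewrite len-castWalk (sym same) refl (project p) = m≤n⇒m≤1+n (len-project≤ p)
  ... | inj₂ _    = s≤s (len-project≤ p)

  -- Leaving and re-entering a copy costs an edge at each end, unless both ends lie in the same copy.
  depth+len-project≤ : ∀ {x y} (p : Walk C x y) → ¬ SameCopy x y →
    depth x + (len (project p) + depth y) ≤ len p
  depth+len-project≤ {x} []      ¬same rewrite ¬SameCopy-self⇒depth≡0 ¬same = z≤n
  depth+len-project≤ {x} {y} (_∷_ {w = x′} e p) ¬same with edge-root e
  ... | inj₂ (dx≡0 , dx′≡0 , _) rewrite dx≡0 =
    s≤s (subst (λ d → d + (len (project p) + depth y) ≤ len p) dx′≡0
          (depth+len-project≤ p (λ (dx′≡1 , _) → 0≢1+n (trans (sym dx′≡0) dx′≡1))))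
  ... | inj₁ same rewrite len-castWalk (sym same) refl (project p) with sameCopy? x′ y
  ...   | no ¬same′ = ≤-trans (+-monoˡ-≤ _ (≤-trans (depth≤1 x) (s≤s (z≤n {depth x′}))))
                              (s≤s (depth+len-project≤ p ¬same′))
  ...   | yes (_ , dy≡1 , rx′≡ry) with depth≡0⊎depth≡1 x
  ...     | inj₂ dx≡1 = ⊥-elim (¬same (dx≡1 , dy≡1 , trans same rx′≡ry))
  ...     | inj₁ dx≡0 rewrite dx≡0 | dy≡1 =
    subst (_≤ suc (len p)) (+-comm 1 (len (project p))) (s≤s (len-project≤ p))

  project-vertices : ∀ {P : Vertex → Set} {x y} (p : Walk C x y) → All P (vertices p) →
    All (λ a → a ≡ root x ⊎ P (inG a)) (vertices (project p))
  project-vertices []      _         = inj₁ refl ∷ []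
  project-vertices {P} (e ∷ p) (_ ∷ ps) with edge-root e
  ... | inj₁ same = All-castWalk (sym same) refl
          (All.map (Sum.map₁ (λ a≡rx′ → trans a≡rx′ (sym same))) (project-vertices p ps))
  ... | inj₂ (_ , dx′≡0 , _) = inj₁ refl ∷
          All.map (λ where (inj₁ refl) → inj₂ (subst P (sym (depth≡0⇒inG-root dx′≡0)) (All-first p ps))
                           (inj₂ pa)   → inj₂ pa)
                  (project-vertices p ps)

  embed : ∀ {a b} → Walk G a b → Walk C (inG a) (inG b)
  embed []      = []
  embed (e ∷ r) = inG-edge e ∷ embed r

  len-embed : ∀ {a b} (r : Walk G a b) → len (embed r) ≡ len r
  len-embed []      = refl
  len-embed (e ∷ r) = cong suc (len-embed r)

  All-embed : ∀ {P : Vertex → Set} {a b} (r : Walk G a b) →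
    All (P ∘ inG) (vertices r) → All P (vertices (embed r))
  All-embed []      (pa ∷ []) = pa ∷ []
  All-embed (e ∷ r) (pa ∷ ps) = pa ∷ All-embed r ps

  ascend : ∀ x → Walk C x (inG (root x))
  ascend x with view x
  ... | inG-view a   = castWalk refl (cong inG (sym (root-inG a))) []
  ... | inH-view w h = castWalk refl (cong inG (sym (root-inH w h))) (inH-inG-edge ∷ [])

  descend : ∀ y → Walk C (inG (root y)) y
  descend y with view y
  ... | inG-view a   = castWalk (cong inG (sym (root-inG a))) refl []
  ... | inH-view w h = castWalk (cong inG (sym (root-inH w h))) refl (inG-inH-edge ∷ [])

  len-ascend : ∀ x → len (ascend x) ≡ depth x
  len-ascend x with view x
  ... | inG-view a   = trans (len-castWalk refl (cong inG (sym (root-inG a))) []) (sym (depth-inG a))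
  ... | inH-view w h =
    trans (len-castWalk refl (cong inG (sym (root-inH w h))) (inH-inG-edge ∷ [])) (sym (depth-inH w h))

  len-descend : ∀ y → len (descend y) ≡ depth y
  len-descend y with view y
  ... | inG-view a   = trans (len-castWalk (cong inG (sym (root-inG a))) refl []) (sym (depth-inG a))
  ... | inH-view w h =
    trans (len-castWalk (cong inG (sym (root-inH w h))) refl (inG-inH-edge ∷ [])) (sym (depth-inH w h))

  All-ascend : ∀ {P : Vertex → Set} x → P x → P (inG (root x)) → All P (vertices (ascend x))
  All-ascend {P} x px pr with view x
  ... | inG-view a   = All-castWalk refl (cong inG (sym (root-inG a))) (px ∷ [])
  ... | inH-view w h =
    All-castWalk refl (cong inG (sym (root-inH w h))) (px ∷ subst (P ∘ inG) (root-inH w h) pr ∷ [])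

  All-descend : ∀ {P : Vertex → Set} y → P (inG (root y)) → P y → All P (vertices (descend y))
  All-descend {P} y pr py with view y
  ... | inG-view a   = All-castWalk (cong inG (sym (root-inG a))) refl (py ∷ [])
  ... | inH-view w h =
    All-castWalk (cong inG (sym (root-inH w h))) refl (subst (P ∘ inG) (root-inH w h) pr ∷ py ∷ [])

  lift : ∀ x y → Walk G (root x) (root y) → Walk C x y
  lift x y r = ascend x ++ᵂ embed r ++ᵂ descend y

  len-lift : ∀ x y (r : Walk G (root x) (root y)) → len (lift x y r) ≡ depth x + (len r + depth y)
  len-lift x y r = begin
    len (ascend x ++ᵂ embed r ++ᵂ descend y)
      ≡⟨ len-++ᵂ (ascend x) _ ⟩
    len (ascend x) + len (embed r ++ᵂ descend y)
      ≡⟨ cong (len (ascend x) +_) (len-++ᵂ (embed r) _) ⟩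
    len (ascend x) + (len (embed r) + len (descend y))
      ≡⟨ cong₂ _+_ (len-ascend x) (cong₂ _+_ (len-embed r) (len-descend y)) ⟩
    depth x + (len r + depth y) ∎
    where open ≡-Reasoning

  All-lift : ∀ {P : Vertex → Set} x y (r : Walk G (root x) (root y)) →
    P x → P y → All (P ∘ inG) (vertices r) → All P (vertices (lift x y r))
  All-lift x y r px py rs =
    All-++ᵂ (ascend x) (All-ascend x px (All-first r rs))
      (All-++ᵂ (embed r) (All-embed r rs) (All-descend y (All-last r rs) py))

  mutualVisibility⇒roots-visible : ∀ {S : Subset (n C)} {Q : Subset m} → (∀ {a} → a ∈ Q → inG a ∈ S) →
    MutualVisibility C S → ∀ {x y} → x ∈ S → y ∈ S → Visible G Q (root x) (root y)
  mutualVisibility⇒roots-visible {S} {Q} Q⊆S S-visible {x} {y} x∈S y∈S with sameCopy? x y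
  ... | yes (_ , _ , rx≡ry) = subst (Visible G Q (root x)) rx≡ry Visible-refl
  ... | no ¬same with S-visible x y x∈S y∈S
  ...   | p , p-shortest , p-avoids = project p , shortest , All.map avoids (project-vertices p p-avoids)
    where
    shortest : IsShortest (project p)
    shortest r = +-cancelʳ-≤ (depth y) _ _ (+-cancelˡ-≤ (depth x) _ _
      (≤-trans (depth+len-project≤ p ¬same) (subst (len p ≤_) (len-lift x y r) (p-shortest (lift x y r)))))

    root-of : ∀ {a z} → inG a ≡ z → a ≡ root z
    root-of {a} refl = sym (root-inG a)

    avoids : ∀ {a} → a ≡ root x ⊎ (inG a ∈ S → inG a ≡ x ⊎ inG a ≡ y) → a ∈ Q → a ≡ root x ⊎ a ≡ root y
    avoids (inj₁ a≡rx) _   = inj₁ a≡rx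
    avoids (inj₂ f)    a∈Q = Sum.map root-of root-of (f (Q⊆S a∈Q))

  module _ {S : Subset (n C)} {Q : Subset m}
           (S∩G⊆Q : ∀ {a} → inG a ∈ S → a ∈ Q) (copies-off-Q : ∀ {w h} → inH w h ∈ S → w ∉ Q) where

    root∈Q⇒inG-root≡ : ∀ {x} → x ∈ S → root x ∈ Q → inG (root x) ≡ x
    root∈Q⇒inG-root≡ {x} x∈S rx∈Q with view x
    ... | inG-view a   = cong inG (root-inG a)
    ... | inH-view w h = ⊥-elim (copies-off-Q x∈S (subst (_∈ Q) (root-inH w h) rx∈Q))

    Visible-lift : ∀ {x y} → ¬ SameCopy x y → x ∈ S → y ∈ S →
      Visible G Q (root x) (root y) → Visible C S x y
    Visible-lift {x} {y} ¬same x∈S y∈S (q , q-shortest , q-avoids) =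
      lift x y q ,
      (λ r → subst (_≤ len r) (sym (len-lift x y q))
        (≤-trans (+-monoʳ-≤ (depth x) (+-monoˡ-≤ (depth y) (q-shortest (project r))))
                 (depth+len-project≤ r ¬same))) ,
      All-lift x y q (λ _ → inj₁ refl) (λ _ → inj₂ refl) (All.map avoids q-avoids)
      where
      avoids : ∀ {c} → (c ∈ Q → c ≡ root x ⊎ c ≡ root y) → inG c ∈ S → inG c ≡ x ⊎ inG c ≡ y
      avoids f c∈S with f (S∩G⊆Q c∈S) | S∩G⊆Q c∈S
      ... | inj₁ refl | rx∈Q = inj₁ (root∈Q⇒inG-root≡ x∈S rx∈Q)
      ... | inj₂ refl | ry∈Q = inj₂ (root∈Q⇒inG-root≡ y∈S ry∈Q)

    Visible-inCopy : ∀ {w h h′} → inG w ∉ S → Visible C S (inH w h) (inH w h′)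
    Visible-inCopy {w} {h} {h′} w∉S with h ≟F h′
    ... | yes refl = Visible-refl
    ... | no h≢h′ with T? (adj H h h′)
    ...   | yes e = from inH-edge⇔ e ∷ [] ,
                    1≤len (h≢h′ ∘ inH-injectiveʳ) ,
                    (λ _ → inj₁ refl) ∷ (λ _ → inj₂ refl) ∷ []
    ...   | no ¬e = inH-inG-edge ∷ inG-inH-edge ∷ [] ,
                    2≤len (h≢h′ ∘ inH-injectiveʳ) (¬e ∘ to inH-edge⇔) ,
                    (λ _ → inj₁ refl) ∷ (λ s → ⊥-elim (w∉S s)) ∷ (λ _ → inj₂ refl) ∷ []

    Visible-sameCopy : ∀ {x y} → SameCopy x y → x ∈ S → Visible C S x y
    Visible-sameCopy {x} {y} (dx≡1 , dy≡1 , rx≡ry) x∈S with view x | view y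
    ... | inG-view a   | _            = ⊥-elim (0≢1+n (trans (sym (depth-inG a)) dx≡1))
    ... | inH-view _ _ | inG-view a   = ⊥-elim (0≢1+n (trans (sym (depth-inG a)) dy≡1))
    ... | inH-view w h | inH-view w′ h′ with trans (sym (root-inH w h)) (trans rx≡ry (root-inH w′ h′))
    ...   | refl = Visible-inCopy (copies-off-Q x∈S ∘ S∩G⊆Q)

    roots-visible⇒mutualVisibility : (∀ {x y} → x ∈ S → y ∈ S → Visible G Q (root x) (root y)) →
      MutualVisibility C S
    roots-visible⇒mutualVisibility roots-visible x y x∈S y∈S with sameCopy? x y
    ... | yes same = Visible-sameCopy same x∈S
    ... | no ¬same = Visible-lift ¬same x∈S y∈S (roots-visible x∈S y∈S)

  liftG≡++⊥ : ∀ Q → liftG G H Q ≡ Q ++ ⊥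
  liftG≡++⊥ Q = lookup-extensionality pointwise
    where
    pointwise : ∀ i → lookup (liftG G H Q) i ≡ lookup (Q ++ ⊥) i
    pointwise i rewrite (lookup (liftG G H Q) i ≡ _ ∋ lookup∘tabulate _ i)
                      | lookup-splitAt m Q ⊥ i
      with splitAt m i
    ... | inj₁ a = refl
    ... | inj₂ j = sym (lookup-replicate j false)

  copiesOver≡⊥++ : ∀ R → copiesOver G H R ≡ ⊥ ++ replicateEach k R
  copiesOver≡⊥++ R = lookup-extensionality pointwise
    where
    pointwise : ∀ i → lookup (copiesOver G H R) i ≡ lookup (⊥ ++ replicateEach k R) i
    pointwise i rewrite (lookup (copiesOver G H R) i ≡ _ ∋ lookup∘tabulate _ i)
                      | lookup-splitAt m ⊥ (replicateEach k R) i
      with splitAt m i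
    ... | inj₁ a = sym (lookup-replicate a false)
    ... | inj₂ j = sym (lookup-replicateEach k R j)

  module _ {Q : Subset m} {T : Subset (m * k)} where

    inG∈⇔ : ∀ {a} → inG a ∈ Q ++ T ⇔ a ∈ Q
    inG∈⇔ = ↑ˡ∈++⇔

    inH∈⇔ : ∀ {w h} → inH w h ∈ Q ++ T ⇔ combine w h ∈ T
    inH∈⇔ = ↑ʳ∈++⇔

    root-∈ : ∀ {x} → x ∈ Q ++ T → root x ∈ Q ⊎ root x ∈ shadow {m} k T
    root-∈ {x} x∈ with view x
    ... | inG-view a   = inj₁ (subst (_∈ Q) (sym (root-inG a)) (to inG∈⇔ x∈))
    ... | inH-view w h = inj₂ (subst (_∈ _) (sym (root-inH w h)) (∈-shadow⁺ {m} k {T} (to inH∈⇔ x∈)))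

    ∈-root : ∀ {u} → u ∈ Q ⊎ u ∈ shadow {m} k T → ∃ λ x → x ∈ Q ++ T × root x ≡ u
    ∈-root {u} (inj₁ u∈Q) = inG u , from inG∈⇔ u∈Q , root-inG u
    ∈-root {u} (inj₂ u∈W) = let h , uh∈T = ∈-shadow⁻ {m} k {T} u∈W in
      inH u h , from inH∈⇔ uh∈T , root-inH u h

    mutualVisibility⇒absCVisible : T ⊆ replicateEach k (∁ Q) →
      MutualVisibility C (Q ++ T) → AbsCVisible G Q (shadow {m} k T)
    mutualVisibility⇒absCVisible T⊆ S-visible =
      (shadow-⊆ {m} k T⊆ ,
       (λ u v u∈ v∈ → visible (inj₂ u∈) (inj₂ v∈)) ,
       (λ u v u∈ v∈ → visible (inj₁ u∈) (inj₂ v∈))) ,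
      (λ u v u∈ v∈ → visible (inj₁ u∈) (inj₁ v∈))
      where
      visible : ∀ {u v} → u ∈ Q ⊎ u ∈ shadow {m} k T → v ∈ Q ⊎ v ∈ shadow {m} k T → Visible G Q u v
      visible u∈ v∈ with ∈-root u∈ | ∈-root v∈
      ... | x , x∈S , refl | y , y∈S , refl =
        mutualVisibility⇒roots-visible (from inG∈⇔) S-visible x∈S y∈S

    absCVisible⇒mutualVisibility : (∀ {u v} → Adj G u v → Adj G v u) →
      AbsCVisible G Q (shadow {m} k T) → MutualVisibility C (Q ++ T)
    absCVisible⇒mutualVisibility Adj-sym ((W⊆∁Q , W-visible , QW-visible) , Q-visible) =
      roots-visible⇒mutualVisibility (to inG∈⇔) copies-off-Q visible
      where
      copies-off-Q : ∀ {w h} → inH w h ∈ Q ++ T → w ∉ Q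
      copies-off-Q wh∈ = x∈∁p⇒x∉p (W⊆∁Q (∈-shadow⁺ {m} k {T} (to inH∈⇔ wh∈)))

      visible : ∀ {x y} → x ∈ Q ++ T → y ∈ Q ++ T → Visible G Q (root x) (root y)
      visible x∈ y∈ with root-∈ x∈ | root-∈ y∈
      ... | inj₁ u∈ | inj₁ v∈ = Q-visible _ _ u∈ v∈
      ... | inj₁ u∈ | inj₂ w∈ = QW-visible _ _ u∈ w∈
      ... | inj₂ w∈ | inj₁ u∈ = Visible-sym Adj-sym (QW-visible _ _ u∈ w∈)
      ... | inj₂ w∈ | inj₂ v∈ = W-visible _ _ w∈ v∈

  liftG∪⊥++≡++ : ∀ Q T → liftG G H Q ∪ (⊥ ++ T) ≡ Q ++ T
  liftG∪⊥++≡++ Q T = begin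
    liftG G H Q ∪ (⊥ ++ T)    ≡⟨ cong (_∪ (⊥ ++ T)) (liftG≡++⊥ Q) ⟩
    (Q ++ ⊥) ∪ (⊥ ++ T)       ≡⟨ zipWith-++ _∨_ Q ⊥ ⊥ T ⟩
    (Q ∪ ⊥) ++ (⊥ ∪ T)        ≡⟨ cong₂ _++_ (∪-identityʳ Q) (∪-identityˡ T) ⟩
    Q ++ T                    ∎
    where open ≡-Reasoning

  CoronaForm : Subset m → Subset (m * k) → Set
  CoronaForm Q T = Nonempty Q × Q ⊂ ⊤ × Nonempty T × T ⊆ replicateEach k (∁ Q) × MutualVisibility C (Q ++ T)

  coronaForm⁺ : ∀ {Q T} → CoronaForm Q T → IsCoronaMVForm G H (Q ++ T)
  coronaForm⁺ {Q} {T} (Q≢∅ , Q⊂⊤ , (j , j∈T) , T⊆ , S-visible) =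
    S-visible , Q , ⊥ ++ T , Q≢∅ , Q⊂⊤ , (m ↑ʳ j , from ↑ʳ∈++⇔ j∈T) ,
    subst (⊥ ++ T ⊆_) (sym (copiesOver≡⊥++ (∁ Q))) (++-⊆⁺ (λ x∈ → x∈) T⊆) ,
    sym (liftG∪⊥++≡++ Q T)

  coronaForm⁻ : ∀ {S} → IsCoronaMVForm G H S → ∃₂ λ Q T → S ≡ Q ++ T × CoronaForm Q T
  coronaForm⁻ (S-visible , Q , T′ , Q≢∅ , Q⊂⊤ , T′≢∅ , T′⊆ , refl) with Data.Vec.splitAt m T′
  ... | T₁ , T , refl with ++-⊆⁻ (subst (T₁ ++ T ⊆_) (copiesOver≡⊥++ (∁ Q)) T′⊆)
  ...   | T₁⊆⊥ , T⊆ with Empty-unique {p = T₁} (λ (_ , a∈T₁) → ∉⊥ (T₁⊆⊥ a∈T₁))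
  ...     | refl = Q , T , liftG∪⊥++≡++ Q T , Q≢∅ , Q⊂⊤ , T≢∅ , T⊆ ,
                   subst (MutualVisibility C) (liftG∪⊥++≡++ Q T) S-visible
    where
    T≢∅ : Nonempty T
    T≢∅ with Nonempty-++⁻ ⊥ T′≢∅
    ... | inj₁ (_ , a∈⊥) = ⊥-elim (∉⊥ a∈⊥)
    ... | inj₂ T≢∅       = T≢∅

module Enumeration (G H : Graph) (Adj-sym : ∀ {u v} → Adj G u v → Adj G v u) (clear : AbsoluteClear G)
  (LQ : List (Subset (n G))) (LQ-enumerates : Enumerates (IsProperNonemptyMV G) LQ)
  (LΩ : Subset (n G) → List (Subset (n G))) (LΩ-enumerates : ∀ Q → Enumerates (MaxAbsCVisible G Q) (LΩ Q))
  where

  open Corona G H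
  open import Data.List.Membership.DecPropositional (Data.Vec.Properties.≡-dec {n = n C} Data.Bool._≟_)
    using () renaming (_∈?_ to _∈ₗ?_)

  ∈-LQ⇔ : ∀ {Q} → Q ∈ₗ LQ ⇔ IsProperNonemptyMV G Q
  ∈-LQ⇔ {Q} = proj₂ LQ-enumerates Q

  ∈-LΩ⇔ : ∀ {Q W} → W ∈ₗ LΩ Q ⇔ MaxAbsCVisible G Q W
  ∈-LΩ⇔ {Q} {W} = proj₂ (LΩ-enumerates Q) W

  block : Subset m → Subset m → List (Subset (n C))
  block Q W = map (Q ++_) (nonemptySubsetsOf (replicateEach k W))

  coronaForms : List (Subset (n C))
  coronaForms = concatMap (λ Q → concatMap (block Q) (LΩ Q)) LQ

  ∈-block⁻ : ∀ {Q W S} → S ∈ₗ block Q W → ∃ λ T → (T ⊆ replicateEach k W × Nonempty T) × S ≡ Q ++ T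
  ∈-block⁻ {Q} {W} S∈ = let T , T∈ , S≡ = ∈-map⁻ (Q ++_) S∈ in
    T , to (∈-nonemptySubsetsOf⇔ (replicateEach k W)) T∈ , S≡

  ∈-coronaForms⁻ : ∀ {S} → S ∈ₗ coronaForms → ∃₂ λ Q W → ∃ λ T →
    Q ∈ₗ LQ × W ∈ₗ LΩ Q × (T ⊆ replicateEach k W × Nonempty T) × S ≡ Q ++ T
  ∈-coronaForms⁻ S∈ =
    let Q , Q∈ , S∈Q = find (∈-concatMap⁻ _ {xs = LQ} S∈)
        W , W∈ , S∈W = find (∈-concatMap⁻ (block Q) {xs = LΩ Q} S∈Q)
        T , T-props , S≡ = ∈-block⁻ {Q} {W} S∈W
    in Q , W , T , Q∈ , W∈ , T-props , S≡

  ∈-coronaForms⁺ : ∀ {Q W T} → Q ∈ₗ LQ → W ∈ₗ LΩ Q → T ⊆ replicateEach k W → Nonempty T →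
    Q ++ T ∈ₗ coronaForms
  ∈-coronaForms⁺ {W = W} Q∈ W∈ T⊆ T≢∅ = ∈-concatMap⁺ _ (lose Q∈ (∈-concatMap⁺ _ (lose W∈
    (∈-map⁺ _ (from (∈-nonemptySubsetsOf⇔ (replicateEach k W)) (T⊆ , T≢∅))))))

  coronaForms-sound : ∀ {S} → S ∈ₗ coronaForms → IsCoronaMVForm G H S
  coronaForms-sound S∈ with ∈-coronaForms⁻ S∈
  ... | Q , W , T , Q∈ , W∈ , (T⊆W , T≢∅) , refl =
    let Q≢∅ , Q⊂⊤ , _                   = to ∈-LQ⇔ Q∈
        W-absCVisible , _               = to ∈-LΩ⇔ W∈
        (W⊆∁Q , _ , _) , _              = W-absCVisible
    in coronaForm⁺ (Q≢∅ , Q⊂⊤ , T≢∅ , replicateEach-mono k W⊆∁Q ∘ T⊆W ,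
                    absCVisible⇒mutualVisibility Adj-sym (AbsCVisible-⊆ (shadow-⊆ {m} k T⊆W) W-absCVisible))

  coronaForms-complete : ∀ {S} → IsCoronaMVForm G H S → S ∈ₗ coronaForms
  coronaForms-complete form with coronaForm⁻ form
  ... | Q , T , refl , Q≢∅ , Q⊂⊤ , T≢∅ , T⊆∁Q , S-visible =
    decidable-stable (Q ++ T ∈ₗ? coronaForms)
      (¬¬-map member (¬¬-maximal-superset (AbsCVisible G Q) shadow-absCVisible))
    where
    shadow-absCVisible : AbsCVisible G Q (shadow {m} k T)
    shadow-absCVisible = mutualVisibility⇒absCVisible T⊆∁Q S-visible

    member : (∃ λ W → MaxAbsCVisible G Q W × shadow {m} k T ⊆ W) → Q ++ T ∈ₗ coronaForms
    member (W , W-maximal , shadow⊆W) =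
      ∈-coronaForms⁺ (from ∈-LQ⇔ (Q≢∅ , Q⊂⊤ , proj₂ shadow-absCVisible)) (from ∈-LΩ⇔ W-maximal)
        (replicateEach-mono k shadow⊆W ∘ ⊆-replicateEach-shadow {m} k T) T≢∅

  blocks-disjoint : ∀ {Q W₁ W₂ S} → Q ∈ₗ LQ → W₁ ∈ₗ LΩ Q → W₂ ∈ₗ LΩ Q →
    S ∈ₗ block Q W₁ → S ∈ₗ block Q W₂ → W₁ ≡ W₂
  blocks-disjoint {Q} {W₁} {W₂} Q∈ W₁∈ W₂∈ S∈₁ S∈₂
    with ∈-block⁻ {Q} {W₁} S∈₁ | ∈-block⁻ {Q} {W₂} S∈₂ | Data.Vec.Properties.≡-dec Data.Bool._≟_ W₁ W₂
  ... | _ | _ | yes W₁≡W₂ = W₁≡W₂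
  ... | T₁ , (T₁⊆W₁ , j , j∈T₁) , S≡₁ | T₂ , (T₂⊆W₂ , _) , S≡₂ | no W₁≢W₂ =
    ⊥-elim (clear Q (proj₁ (to ∈-LQ⇔ Q∈)) W₁ W₂ (to ∈-LΩ⇔ W₁∈) (to ∈-LΩ⇔ W₂∈) W₁≢W₂
      (quotient k j , x∈p∩q⁺ (to (∈-replicateEach⇔ k) (T₁⊆W₁ j∈T₁) , to (∈-replicateEach⇔ k) (T₂⊆W₂ j∈T₂))))
    where
    j∈T₂ : j ∈ T₂
    j∈T₂ = subst (j ∈_) (++-injectiveʳ Q Q (trans (sym S≡₁) S≡₂)) j∈T₁

  prefix : ∀ {Q S} → S ∈ₗ concatMap (block Q) (LΩ Q) → ∃ λ T → S ≡ Q ++ T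
  prefix {Q} S∈ = let W , _ , S∈W = find (∈-concatMap⁻ (block Q) {xs = LΩ Q} S∈)
                      T , _ , S≡  = ∈-block⁻ {Q} {W} S∈W
                  in T , S≡

  coronaForms-unique : Unique coronaForms
  coronaForms-unique = concatMap-unique _ (proj₁ LQ-enumerates)
    (λ {Q} Q∈ → concatMap-unique (block Q) (proj₁ (LΩ-enumerates Q))
                  (λ {W} _ → Unique.map⁺ (++-injectiveʳ Q Q) (nonemptySubsetsOf-unique (replicateEach k W)))
                  (blocks-disjoint Q∈))
    (λ {Q₁} {Q₂} _ _ S∈₁ S∈₂ → let _ , S≡₁ = prefix S∈₁
                                   _ , S≡₂ = prefix S∈₂
                               in ++-injectiveˡ Q₁ Q₂ (trans (sym S≡₁) S≡₂))

  module _ (x : ℕ) where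

    sumOver-block : ∀ Q W → sumOver (block Q W) (λ S → x ^ ∣ S ∣) ≡ x ^ ∣ Q ∣ * ((1 + x) ^ (∣ W ∣ * k) ∸ 1)
    sumOver-block Q W = let Ts = nonemptySubsetsOf (replicateEach k W) in begin
      sumOver (map (Q ++_) (nonemptySubsetsOf (replicateEach k W))) (λ S → x ^ ∣ S ∣)
        ≡⟨ sumOver-map (Q ++_) Ts _ ⟩
      sumOver (nonemptySubsetsOf (replicateEach k W)) (λ T → x ^ ∣ Q ++ T ∣)
        ≡⟨ sumOver-cong Ts (λ T → trans (cong (x ^_) (∣p++q∣≡∣p∣+∣q∣ Q T)) (^-distribˡ-+-* x ∣ Q ∣ ∣ T ∣)) ⟩
      sumOver (nonemptySubsetsOf (replicateEach k W)) (λ T → x ^ ∣ Q ∣ * x ^ ∣ T ∣)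
        ≡⟨ sumOver-*ˡ (x ^ ∣ Q ∣) Ts _ ⟩
      x ^ ∣ Q ∣ * sumOver (nonemptySubsetsOf (replicateEach k W)) (λ T → x ^ ∣ T ∣)
        ≡⟨ cong (x ^ ∣ Q ∣ *_) (sumOver-nonemptySubsetsOf x (replicateEach k W)) ⟩
      x ^ ∣ Q ∣ * ((1 + x) ^ ∣ replicateEach k W ∣ ∸ 1)
        ≡⟨ cong (λ e → x ^ ∣ Q ∣ * ((1 + x) ^ e ∸ 1)) (∣replicateEach∣ k W) ⟩
      x ^ ∣ Q ∣ * ((1 + x) ^ (∣ W ∣ * k) ∸ 1) ∎
      where open ≡-Reasoning

    sumOver-coronaForms : sumOver coronaForms (λ S → x ^ ∣ S ∣)
      ≡ sumOver LQ (λ Q → sumOver (LΩ Q) (λ W → (1 + x) ^ (∣ W ∣ * k) ∸ 1) * x ^ ∣ Q ∣)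
    sumOver-coronaForms = trans (sumOver-concatMap _ LQ _) (sumOver-cong LQ λ Q → begin
      sumOver (concatMap (block Q) (LΩ Q)) (λ S → x ^ ∣ S ∣)
        ≡⟨ sumOver-concatMap (block Q) (LΩ Q) _ ⟩
      sumOver (LΩ Q) (λ W → sumOver (block Q W) (λ S → x ^ ∣ S ∣))
        ≡⟨ sumOver-cong (LΩ Q) (sumOver-block Q) ⟩
      sumOver (LΩ Q) (λ W → x ^ ∣ Q ∣ * ((1 + x) ^ (∣ W ∣ * k) ∸ 1))
        ≡⟨ sumOver-*ˡ (x ^ ∣ Q ∣) (LΩ Q) _ ⟩
      x ^ ∣ Q ∣ * sumOver (LΩ Q) (λ W → (1 + x) ^ (∣ W ∣ * k) ∸ 1)
        ≡⟨ *-comm (x ^ ∣ Q ∣) _ ⟩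
      sumOver (LΩ Q) (λ W → (1 + x) ^ (∣ W ∣ * k) ∸ 1) * x ^ ∣ Q ∣ ∎)
      where open ≡-Reasoning

mainTheorem17 : (G H : Graph) →
    IsConnectedSimpleGraph G → AbsoluteClear G → IsConnectedSimpleGraph H →
    (LS : List (Subset (n G + n G * n H))) → Enumerates (IsCoronaMVForm G H) LS →
    (LQ : List (Subset (n G))) → Enumerates (IsProperNonemptyMV G) LQ →
    (LΩ : Subset (n G) → List (Subset (n G))) →
    (∀ Q → Enumerates (MaxAbsCVisible G Q) (LΩ Q)) →
    (x : ℕ) →
    sumOver LS (λ S → x ^ ∣ S ∣)
      ≡ sumOver LQ (λ Q → sumOver (LΩ Q) (λ W → (1 + x) ^ (∣ W ∣ * n H) ∸ 1) * x ^ ∣ Q ∣)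
mainTheorem17 G H (G-symmetric , _) clear _
              LS (LS-unique , LS-enumerates) LQ LQ-enumerates LΩ LΩ-enumerates x =
  trans (sumOver-unique-⇔ LS-unique coronaForms-unique LS⇔coronaForms (λ S → x ^ ∣ S ∣))
        (sumOver-coronaForms x)
  where
  Adj-sym : ∀ {u v} → Adj G u v → Adj G v u
  Adj-sym {u} {v} = subst T (G-symmetric u v)

  open Enumeration G H Adj-sym clear LQ LQ-enumerates LΩ LΩ-enumerates

  LS⇔coronaForms : ∀ {S} → S ∈ₗ LS ⇔ S ∈ₗ coronaForms
  LS⇔coronaForms {S} = mk⇔ (coronaForms-complete ∘ to (LS-enumerates S))
                           (from (LS-enumerates S) ∘ coronaForms-sound)
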